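{- Let $G$ be a graph and $S\subseteq V(G)$ with $|S|=s$. Then $\mathcal{E}(G;S,q)$ is linear in $q$ if and only if for all $1\leq k\leq s$, $$\sum_{W\in\binom{S}{k}}|\mathrm{Obs}(G;W)|=\binom{s-1}{k-1}\sum_{v\in S}|\mathrm{Obs}(G;\{v\})|.$$
   Context: Graphs are finite and simple; $N[X]$ is the closed neighborhood of $X$. Power domination process on a graph $H$ from $T\subseteq V(H)$: set $B:=N[T]$; then, while some $x\in B$ has exactly one vertex $y$ of $N[x]$ outside $B$, add $y$ to $B$. The final set is $\mathrm{Obs}(H;T)$ (with $\mathrm{Obs}(H;\emptyset)=\emptyset$). For $S\subseteq V(H)$, $\mathcal{E}(H;S,q)=\sum_{W\subseteq S}|\mathrm{Obs}(H;W)|\,q^{|S\setminus W|}(1-q)^{|W|}$. $\binom{S}{k}$ is the set of $k$-element subsets of $S$. -}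

module Defs where

open import Data.Bool using (Bool; true; false; _∧_; _∨_; not; if_then_else_; T)
open import Data.Nat using (ℕ; zero; suc; _∸_; _≡ᵇ_)
open import Data.Fin using (Fin; _≟_)
open import Data.Fin.Subset using (Subset; ∣_∣; _∈_)
open import Data.Vec using (Vec; []; _∷_; lookup; tabulate; _[_]≔_)
open import Data.List using (List; []; _∷_; map; filterᵇ; allFin; length; _++_; foldr)
open import Data.Bool.ListAction using (any)
open import Data.Integer using (ℤ; +_; _*_; _+_; -_)
open import Relation.Binary.PropositionalEquality using (_≡_)
open import Relation.Nullary.Decidable using (⌊_⌋)

record Graph (n : ℕ) : Set where
  field
    adj     : Fin n → Fin n → Bool
    adj-sym : ∀ x y → adj x y ≡ adj y x
    adj-irr : ∀ x → adj x x ≡ false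
open Graph public

inN : ∀ {n} → Graph n → Fin n → Fin n → Bool
inN G x y = ⌊ x ≟ y ⌋ ∨ adj G x y

closedNbhd : ∀ {n} → Graph n → Subset n → Subset n
closedNbhd {n} G T = tabulate λ y → any (λ x → lookup T x ∧ inN G x y) (allFin n)

outside : ∀ {n} → Graph n → Subset n → Fin n → List (Fin n)
outside {n} G B x = filterᵇ (λ y → inN G x y ∧ not (lookup B y)) (allFin n)

forceStep : ∀ {n} → Graph n → Subset n → Subset n
forceStep {n} G B = go (allFin n)
  where
  go : List (Fin n) → Subset n
  go [] = B
  go (x ∷ xs) with lookup B x | outside G B x
  ... | true | y ∷ [] = B [ y ]≔ true
  ... | _    | _      = go xs

iterate : ∀ {A : Set} → ℕ → (A → A) → A → A
iterate zero    f a = a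
iterate (suc k) f a = iterate k f (f a)

-- Each non-trivial step adds a vertex, so after n steps the process has
-- terminated; the result is the final set Obs(H;T).
Obs : ∀ {n} → Graph n → Subset n → Subset n
Obs {n} G T = iterate n (forceStep G) (closedNbhd G T)

allSubsets : (n : ℕ) → List (Subset n)
allSubsets zero    = [] ∷ []
allSubsets (suc n) = map (false ∷_) (allSubsets n) ++ map (true ∷_) (allSubsets n)

_⊆ᵇ_ : ∀ {n} → Subset n → Subset n → Bool
[]      ⊆ᵇ []      = true
(w ∷ W) ⊆ᵇ (s ∷ S) = (not w ∨ s) ∧ (W ⊆ᵇ S)

subsetsOf : ∀ {n} → Subset n → List (Subset n)
subsetsOf {n} S = filterᵇ (_⊆ᵇ S) (allSubsets n)

subsetsOfSize : ∀ {n} → Subset n → ℕ → List (Subset n)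
subsetsOfSize S k = filterᵇ (λ W → ∣ W ∣ ≡ᵇ k) (subsetsOf S)

elemsOf : ∀ {n} → Subset n → List (Fin n)
elemsOf {n} S = filterᵇ (lookup S) (allFin n)

singleton : ∀ {n} → Fin n → Subset n
singleton {n} v = tabulate λ u → ⌊ u ≟ v ⌋

-- Polynomials in q with integer coefficients, as coefficient lists
-- (index i = coefficient of q^i)

Poly : Set
Poly = List ℤ

_+ₚ_ : Poly → Poly → Poly
[]       +ₚ qs       = qs
(p ∷ ps) +ₚ []       = p ∷ ps
(p ∷ ps) +ₚ (q ∷ qs) = (p + q) ∷ (ps +ₚ qs)

scaleₚ : ℤ → Poly → Poly
scaleₚ c = map (c *_)

_*ₚ_ : Poly → Poly → Poly
[]       *ₚ qs = []
(p ∷ ps) *ₚ qs = scaleₚ p qs +ₚ (+ 0 ∷ (ps *ₚ qs))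

oneₚ : Poly
oneₚ = + 1 ∷ []

qₚ : Poly
qₚ = + 0 ∷ + 1 ∷ []

1-qₚ : Poly
1-qₚ = + 1 ∷ - (+ 1) ∷ []

_^ₚ_ : Poly → ℕ → Poly
p ^ₚ zero  = oneₚ
p ^ₚ suc k = p *ₚ (p ^ₚ k)

sumₚ : List Poly → Poly
sumₚ = foldr _+ₚ_ []

coeff : Poly → ℕ → ℤ
coeff []       i       = + 0
coeff (p ∷ ps) zero    = p
coeff (p ∷ ps) (suc i) = coeff ps i

IsLinear : Poly → Set
IsLinear p = ∀ i → coeff p (suc (suc i)) ≡ + 0

expObs : ∀ {n} → Graph n → Subset n → Poly
expObs G S = sumₚ (map term (subsetsOf S))
  where
  term : _ → Poly
  term W = scaleₚ (+ ∣ Obs G W ∣) ((qₚ ^ₚ (∣ S ∣ ∸ ∣ W ∣)) *ₚ (1-qₚ ^ₚ ∣ W ∣))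

{-# OPTIONS --safe #-}
module Submission where

-- Grouping the subsets W ⊆ S by size k gives E(G;S,q) = Σ_{k ≤ s} N_k q^(s-k) (1-q)^k with
-- N_k = Σ_{|W| = k} |Obs(G;W)|, and N_0 = 0 since Obs(G;∅) = ∅. The Bernstein polynomials
-- q^(s-k) (1-q)^k are linearly independent: the constant term of Σ_k d_k q^(s-k) (1-q)^k is d_s,
-- and removing that term leaves q times the sum for s - 1. Moreover Σ_k C(s,k) q^(s-k) (1-q)^k = 1
-- and Σ_k C(s-1,k-1) q^(s-k) (1-q)^k = 1 - q. So if E = a + b q = (a + b) - b (1 - q), then
-- N_k = (a + b) C(s,k) - b C(s-1,k-1); N_0 = 0 forces a + b = 0, hence N_k = C(s-1,k-1) N_1.
-- Conversely these N_k give E = N_1 (1 - q). Finally N_1 = Σ_{v ∈ S} |Obs(G;{v})|, as the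
-- one-element subsets of S are the singletons of its elements.

open import Defs

module Bernstein where

  open import Function.Base using (_∘_)
  open import Function.Bundles using (_⇔_; mk⇔; module Equivalence)
  open import Data.Bool.Base using (true; false; if_then_else_)
  open import Data.Nat.Base using (ℕ; zero; suc; _≡ᵇ_; _≤_; _∸_; z≤n; s≤s)
  import Data.Nat.Base as ℕ
  import Data.Nat.Properties as ℕₚ
  open import Data.Nat.Combinatorics using (_C_; nCk+nC[k+1]≡[n+1]C[k+1]; k>n⇒nCk≡0)
  open import Data.Nat.ListAction using (sum)
  open import Data.Integer.Base using (ℤ; +_; -_; _+_; _-_; _*_; 0ℤ; 1ℤ)
  open import Data.Integer.Properties
    using ( +-identityˡ; +-identityʳ; *-identityˡ; *-identityʳ; *-zeroˡ; *-zeroʳ; *-assoc; *-comm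
          ; *-distribʳ-+; +-comm; pos-+; pos-*; +-injective; +-0-abelianGroup)
  open import Algebra.Properties.AbelianGroup +-0-abelianGroup using (∙-cancelʳ)
  open import Data.Integer.Tactic.RingSolver using (solve-∀)
  open import Data.List.Base using (List; []; _∷_; map; filterᵇ)
  open import Data.List.Relation.Unary.All using (All; []; _∷_)
  open import Data.Sum.Base using (inj₁; inj₂)
  open import Relation.Nullary.Negation using (contradiction)
  open import Relation.Binary.PropositionalEquality
    using (_≡_; _≢_; refl; sym; trans; cong; cong₂; module ≡-Reasoning)
  open ≡-Reasoning

  -- Power series in q are represented by their coefficient sequences ℕ → ℤ.
  q·_ : (ℕ → ℤ) → ℕ → ℤ
  (q· f) zero    = 0ℤ
  (q· f) (suc i) = f i

  [1-q]·_ : (ℕ → ℤ) → ℕ → ℤ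
  ([1-q]· f) i = f i - (q· f) i

  δ : ℕ → ℕ → ℤ
  δ m k = if m ≡ᵇ k then 1ℤ else 0ℤ

  δ-refl : ∀ m → δ m m ≡ 1ℤ
  δ-refl zero    = refl
  δ-refl (suc m) = δ-refl m

  δ-≢ : ∀ {m k} → m ≢ k → δ m k ≡ 0ℤ
  δ-≢ {zero}  {zero}  m≢k = contradiction refl m≢k
  δ-≢ {zero}  {suc k} m≢k = refl
  δ-≢ {suc m} {zero}  m≢k = refl
  δ-≢ {suc m} {suc k} m≢k = δ-≢ (m≢k ∘ cong suc)

  q·-cong : ∀ {f g : ℕ → ℤ} → (∀ i → f i ≡ g i) → ∀ i → (q· f) i ≡ (q· g) i
  q·-cong f≗g zero    = refl
  q·-cong f≗g (suc i) = f≗g i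

  [1-q]·-cong : ∀ {f g : ℕ → ℤ} → (∀ i → f i ≡ g i) → ∀ i → ([1-q]· f) i ≡ ([1-q]· g) i
  [1-q]·-cong f≗g i = cong₂ _-_ (f≗g i) (q·-cong f≗g i)

  q·-0 : ∀ i → (q· λ _ → 0ℤ) i ≡ 0ℤ
  q·-0 zero    = refl
  q·-0 (suc i) = refl

  q·-+ : ∀ (f g : ℕ → ℤ) i → (q· λ j → f j + g j) i ≡ (q· f) i + (q· g) i
  q·-+ f g zero    = refl
  q·-+ f g (suc i) = refl

  q·-* : ∀ c (f : ℕ → ℤ) i → (q· λ j → c * f j) i ≡ c * (q· f) i
  q·-* c f zero    = sym (*-zeroʳ c)
  q·-* c f (suc i) = refl

  coeff-+ₚ : ∀ p r i → coeff (p +ₚ r) i ≡ coeff p i + coeff r i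
  coeff-+ₚ []      r       i       = sym (+-identityˡ _)
  coeff-+ₚ (x ∷ p) []      i       = sym (+-identityʳ _)
  coeff-+ₚ (x ∷ p) (y ∷ r) zero    = refl
  coeff-+ₚ (x ∷ p) (y ∷ r) (suc i) = coeff-+ₚ p r i

  coeff-scaleₚ : ∀ c p i → coeff (scaleₚ c p) i ≡ c * coeff p i
  coeff-scaleₚ c []      i       = sym (*-zeroʳ c)
  coeff-scaleₚ c (x ∷ p) zero    = refl
  coeff-scaleₚ c (x ∷ p) (suc i) = coeff-scaleₚ c p i

  coeff-0∷ : ∀ p i → coeff (0ℤ ∷ p) i ≡ (q· coeff p) i
  coeff-0∷ p zero    = refl
  coeff-0∷ p (suc i) = refl

  coeff-∷*ₚ : ∀ c p r i → coeff ((c ∷ p) *ₚ r) i ≡ c * coeff r i + (q· coeff (p *ₚ r)) i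
  coeff-∷*ₚ c p r i = begin
    coeff (scaleₚ c r +ₚ (0ℤ ∷ p *ₚ r)) i
      ≡⟨ coeff-+ₚ (scaleₚ c r) _ i ⟩
    coeff (scaleₚ c r) i + coeff (0ℤ ∷ p *ₚ r) i
      ≡⟨ cong₂ _+_ (coeff-scaleₚ c r i) (coeff-0∷ (p *ₚ r) i) ⟩
    c * coeff r i + (q· coeff (p *ₚ r)) i ∎

  coeff-*ₚ-zeroˡ : ∀ p r → (∀ i → coeff p i ≡ 0ℤ) → ∀ i → coeff (p *ₚ r) i ≡ 0ℤ
  coeff-*ₚ-zeroˡ []      r p≗0 i = refl
  coeff-*ₚ-zeroˡ (c ∷ p) r p≗0 i = begin
    coeff ((c ∷ p) *ₚ r) i                 ≡⟨ coeff-∷*ₚ c p r i ⟩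
    c * coeff r i + (q· coeff (p *ₚ r)) i  ≡⟨ cong₂ _+_ (cong (_* coeff r i) (p≗0 0))
                                                       (q·-cong (coeff-*ₚ-zeroˡ p r (p≗0 ∘ suc)) i) ⟩
    0ℤ * coeff r i + (q· λ _ → 0ℤ) i       ≡⟨ cong₂ _+_ (*-zeroˡ (coeff r i)) (q·-0 i) ⟩
    0ℤ                                     ∎

  coeff-*ₚ-congˡ : ∀ p p′ r → (∀ i → coeff p i ≡ coeff p′ i) →
                   ∀ i → coeff (p *ₚ r) i ≡ coeff (p′ *ₚ r) i
  coeff-*ₚ-congˡ []      p′        r p≗p′ i = sym (coeff-*ₚ-zeroˡ p′ r (sym ∘ p≗p′) i)
  coeff-*ₚ-congˡ (c ∷ p) []        r p≗p′ i = coeff-*ₚ-zeroˡ (c ∷ p) r p≗p′ i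
  coeff-*ₚ-congˡ (c ∷ p) (c′ ∷ p′) r p≗p′ i = begin
    coeff ((c ∷ p) *ₚ r) i                   ≡⟨ coeff-∷*ₚ c p r i ⟩
    c * coeff r i + (q· coeff (p *ₚ r)) i    ≡⟨ cong₂ _+_ (cong (_* coeff r i) (p≗p′ 0))
                                                         (q·-cong (coeff-*ₚ-congˡ p p′ r (p≗p′ ∘ suc)) i) ⟩
    c′ * coeff r i + (q· coeff (p′ *ₚ r)) i  ≡⟨ coeff-∷*ₚ c′ p′ r i ⟨
    coeff ((c′ ∷ p′) *ₚ r) i                 ∎

  coeff-[c]*ₚ : ∀ c r i → coeff ((c ∷ []) *ₚ r) i ≡ c * coeff r i
  coeff-[c]*ₚ c r i = begin
    coeff ((c ∷ []) *ₚ r) i                ≡⟨ coeff-∷*ₚ c [] r i ⟩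
    c * coeff r i + (q· λ _ → 0ℤ) i        ≡⟨ cong (λ x → c * coeff r i + x) (q·-0 i) ⟩
    c * coeff r i + 0ℤ                     ≡⟨ +-identityʳ _ ⟩
    c * coeff r i                          ∎

  coeff-qₚ*ₚ : ∀ r i → coeff (qₚ *ₚ r) i ≡ (q· coeff r) i
  coeff-qₚ*ₚ r i = begin
    coeff (qₚ *ₚ r) i
      ≡⟨ coeff-∷*ₚ 0ℤ (1ℤ ∷ []) r i ⟩
    0ℤ * coeff r i + (q· coeff ((1ℤ ∷ []) *ₚ r)) i
      ≡⟨ cong₂ _+_ (*-zeroˡ (coeff r i)) (q·-cong (λ j → trans (coeff-[c]*ₚ 1ℤ r j) (*-identityˡ _)) i) ⟩
    0ℤ + (q· coeff r) i
      ≡⟨ +-identityˡ _ ⟩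
    (q· coeff r) i ∎

  coeff-1-qₚ*ₚ : ∀ r i → coeff (1-qₚ *ₚ r) i ≡ ([1-q]· coeff r) i
  coeff-1-qₚ*ₚ r i = begin
    coeff (1-qₚ *ₚ r) i
      ≡⟨ coeff-∷*ₚ 1ℤ (- 1ℤ ∷ []) r i ⟩
    1ℤ * coeff r i + (q· coeff ((- 1ℤ ∷ []) *ₚ r)) i
      ≡⟨ cong (λ x → 1ℤ * coeff r i + x) (trans (q·-cong (coeff-[c]*ₚ (- 1ℤ) r) i) (q·-* (- 1ℤ) (coeff r) i)) ⟩
    1ℤ * coeff r i + - 1ℤ * (q· coeff r) i
      ≡⟨ ring (coeff r i) ((q· coeff r) i) ⟩
    ([1-q]· coeff r) i ∎
    where
    ring : ∀ x y → 1ℤ * x + - 1ℤ * y ≡ x - y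
    ring = solve-∀

  bernstein : ℕ → ℕ → ℕ → ℤ
  bernstein zero    zero    = δ 0
  bernstein zero    (suc b) = [1-q]· bernstein zero b
  bernstein (suc a) b       = q· bernstein a b

  coeff-bernstein : ∀ a b i → coeff ((qₚ ^ₚ a) *ₚ (1-qₚ ^ₚ b)) i ≡ bernstein a b i
  coeff-bernstein zero    b i = trans (coeff-[c]*ₚ 1ℤ (1-qₚ ^ₚ b) i) (trans (*-identityˡ _) (coeff-1-q^ b i))
    where
    coeff-1-q^ : ∀ b i → coeff (1-qₚ ^ₚ b) i ≡ bernstein 0 b i
    coeff-1-q^ zero    zero    = refl
    coeff-1-q^ zero    (suc i) = refl
    coeff-1-q^ (suc b) i       = trans (coeff-1-qₚ*ₚ (1-qₚ ^ₚ b) i) ([1-q]·-cong (coeff-1-q^ b) i)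
  coeff-bernstein (suc a) b i = begin
    coeff ((qₚ *ₚ (qₚ ^ₚ a)) *ₚ (1-qₚ ^ₚ b)) i
      ≡⟨ coeff-*ₚ-congˡ (qₚ *ₚ (qₚ ^ₚ a)) (0ℤ ∷ qₚ ^ₚ a) _
           (λ j → trans (coeff-qₚ*ₚ (qₚ ^ₚ a) j) (sym (coeff-0∷ (qₚ ^ₚ a) j))) i ⟩
    coeff ((0ℤ ∷ qₚ ^ₚ a) *ₚ (1-qₚ ^ₚ b)) i
      ≡⟨ coeff-∷*ₚ 0ℤ (qₚ ^ₚ a) (1-qₚ ^ₚ b) i ⟩
    0ℤ * coeff (1-qₚ ^ₚ b) i + (q· coeff ((qₚ ^ₚ a) *ₚ (1-qₚ ^ₚ b))) i
      ≡⟨ cong₂ _+_ (*-zeroˡ (coeff (1-qₚ ^ₚ b) i)) (q·-cong (coeff-bernstein a b) i) ⟩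
    0ℤ + bernstein (suc a) b i
      ≡⟨ +-identityˡ _ ⟩
    bernstein (suc a) b i ∎

  -- Σ_{k ≤ s} d k q^(s ∸ k) (1 - q)^k
  bernsteinSum : ℕ → (ℕ → ℤ) → ℕ → ℤ
  bernsteinSum zero    d i = d 0 * bernstein 0 0 i
  bernsteinSum (suc s) d i = (q· bernsteinSum s d) i + d (suc s) * bernstein 0 (suc s) i

  bernsteinSum-cong : ∀ s {d e : ℕ → ℤ} → (∀ k → k ≤ s → d k ≡ e k) →
                      ∀ i → bernsteinSum s d i ≡ bernsteinSum s e i
  bernsteinSum-cong zero    d≗e i = cong (_* bernstein 0 0 i) (d≗e 0 z≤n)
  bernsteinSum-cong (suc s) d≗e i =
    cong₂ _+_ (q·-cong (bernsteinSum-cong s (λ k k≤s → d≗e k (ℕₚ.m≤n⇒m≤1+n k≤s))) i)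
              (cong (_* bernstein 0 (suc s) i) (d≗e (suc s) ℕₚ.≤-refl))

  bernsteinSum-+ : ∀ s (d e : ℕ → ℤ) i →
                   bernsteinSum s (λ k → d k + e k) i ≡ bernsteinSum s d i + bernsteinSum s e i
  bernsteinSum-+ zero    d e i = *-distribʳ-+ (bernstein 0 0 i) (d 0) (e 0)
  bernsteinSum-+ (suc s) d e i = begin
    (q· bernsteinSum s (λ k → d k + e k)) i + (d (suc s) + e (suc s)) * b
      ≡⟨ cong₂ _+_ (trans (q·-cong (bernsteinSum-+ s d e) i) (q·-+ (bernsteinSum s d) (bernsteinSum s e) i))
                   (*-distribʳ-+ b (d (suc s)) (e (suc s))) ⟩
    ((q· bernsteinSum s d) i + (q· bernsteinSum s e) i) + (d (suc s) * b + e (suc s) * b)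
      ≡⟨ interchange ((q· bernsteinSum s d) i) ((q· bernsteinSum s e) i) (d (suc s) * b) (e (suc s) * b) ⟩
    bernsteinSum (suc s) d i + bernsteinSum (suc s) e i ∎
    where
    b = bernstein 0 (suc s) i
    interchange : ∀ x y u v → (x + y) + (u + v) ≡ (x + u) + (y + v)
    interchange = solve-∀

  bernsteinSum-* : ∀ s c (d : ℕ → ℤ) i → bernsteinSum s (λ k → c * d k) i ≡ c * bernsteinSum s d i
  bernsteinSum-* zero    c d i = *-assoc c (d 0) (bernstein 0 0 i)
  bernsteinSum-* (suc s) c d i = begin
    (q· bernsteinSum s (λ k → c * d k)) i + c * d (suc s) * b
      ≡⟨ cong (_+ c * d (suc s) * b) (trans (q·-cong (bernsteinSum-* s c d) i) (q·-* c (bernsteinSum s d) i)) ⟩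
    c * (q· bernsteinSum s d) i + c * d (suc s) * b
      ≡⟨ distrib c ((q· bernsteinSum s d) i) (d (suc s)) b ⟩
    c * bernsteinSum (suc s) d i ∎
    where
    b = bernstein 0 (suc s) i
    distrib : ∀ c x y z → c * x + c * y * z ≡ c * (x + y * z)
    distrib = solve-∀

  bernsteinSum-zero : ∀ s (d : ℕ → ℤ) → (∀ k → k ≤ s → d k ≡ 0ℤ) →
                      ∀ i → bernsteinSum s d i ≡ 0ℤ
  bernsteinSum-zero s d d≗0 i = begin
    bernsteinSum s d i
      ≡⟨ bernsteinSum-cong s (λ k k≤s → trans (d≗0 k k≤s) (sym (*-zeroˡ (d k)))) i ⟩
    bernsteinSum s (λ k → 0ℤ * d k) i
      ≡⟨ bernsteinSum-* s 0ℤ d i ⟩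
    0ℤ * bernsteinSum s d i
      ≡⟨ *-zeroˡ (bernsteinSum s d i) ⟩
    0ℤ ∎

  bernstein-0-b-0 : ∀ b → bernstein 0 b 0 ≡ 1ℤ
  bernstein-0-b-0 zero    = refl
  bernstein-0-b-0 (suc b) = trans (+-identityʳ _) (bernstein-0-b-0 b)

  bernsteinSum-constant : ∀ s d → bernsteinSum s d 0 ≡ d s
  bernsteinSum-constant zero    d = *-identityʳ (d 0)
  bernsteinSum-constant (suc s) d = begin
    0ℤ + d (suc s) * bernstein 0 (suc s) 0  ≡⟨ +-identityˡ _ ⟩
    d (suc s) * bernstein 0 (suc s) 0       ≡⟨ cong (d (suc s) *_) (bernstein-0-b-0 (suc s)) ⟩
    d (suc s) * 1ℤ                          ≡⟨ *-identityʳ _ ⟩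
    d (suc s)                               ∎

  module _ {d e : ℕ → ℤ} where

    bernsteinSum-≗⇒top : ∀ s → (∀ i → bernsteinSum s d i ≡ bernsteinSum s e i) → d s ≡ e s
    bernsteinSum-≗⇒top s d≈e =
      trans (sym (bernsteinSum-constant s d)) (trans (d≈e 0) (bernsteinSum-constant s e))

    bernsteinSum-≗⇒lower : ∀ s → (∀ i → bernsteinSum (suc s) d i ≡ bernsteinSum (suc s) e i) →
                           ∀ i → bernsteinSum s d i ≡ bernsteinSum s e i
    bernsteinSum-≗⇒lower s d≈e i = ∙-cancelʳ (e (suc s) * b) (bernsteinSum s d i) (bernsteinSum s e i)
      (trans (cong (λ c → bernsteinSum s d i + c * b) (sym (bernsteinSum-≗⇒top (suc s) d≈e))) (d≈e (suc i)))
      where b = bernstein 0 (suc s) (suc i)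

    bernsteinSum-injective : ∀ s → (∀ i → bernsteinSum s d i ≡ bernsteinSum s e i) →
                             ∀ k → k ≤ s → d k ≡ e k
    bernsteinSum-injective zero    d≈e .zero z≤n = bernsteinSum-≗⇒top zero d≈e
    bernsteinSum-injective (suc s) d≈e k k≤1+s with ℕₚ.m≤n⇒m<n∨m≡n k≤1+s
    ... | inj₁ (s≤s k≤s) = bernsteinSum-injective s (bernsteinSum-≗⇒lower s d≈e) k k≤s
    ... | inj₂ refl      = bernsteinSum-≗⇒top (suc s) d≈e

  bernsteinSum-δ : ∀ {m} s → m ≤ s → ∀ i → bernsteinSum s (δ m) i ≡ bernstein (s ∸ m) m i
  bernsteinSum-δ zero z≤n i = *-identityˡ (bernstein 0 0 i)
  bernsteinSum-δ {m} (suc s) m≤1+s i with ℕₚ.m≤n⇒m<n∨m≡n m≤1+s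
  ... | inj₁ (s≤s m≤s) = begin
    (q· bernsteinSum s (δ m)) i + δ m (suc s) * bernstein 0 (suc s) i
      ≡⟨ cong₂ _+_ (q·-cong (bernsteinSum-δ s m≤s) i)
                   (cong (_* bernstein 0 (suc s) i) (δ-≢ (ℕₚ.<⇒≢ (s≤s m≤s)))) ⟩
    bernstein (suc (s ∸ m)) m i + 0ℤ
      ≡⟨ +-identityʳ _ ⟩
    bernstein (suc (s ∸ m)) m i
      ≡⟨ cong (λ a → bernstein a m i) (ℕₚ.+-∸-assoc 1 m≤s) ⟨
    bernstein (suc s ∸ m) m i ∎
  ... | inj₂ refl = begin
    (q· bernsteinSum s (δ (suc s))) i + δ (suc s) (suc s) * bernstein 0 (suc s) i
      ≡⟨ cong₂ _+_ (trans (q·-cong (bernsteinSum-zero s (δ (suc s)) (λ k k≤s → δ-≢ (ℕₚ.>⇒≢ (s≤s k≤s)))) i)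
                          (q·-0 i))
                   (cong (_* bernstein 0 (suc s) i) (δ-refl (suc s))) ⟩
    0ℤ + 1ℤ * bernstein 0 (suc s) i
      ≡⟨ trans (+-identityˡ _) (*-identityˡ _) ⟩
    bernstein 0 (suc s) i
      ≡⟨ cong (λ a → bernstein a (suc s) i) (ℕₚ.n∸n≡0 s) ⟨
    bernstein (s ∸ s) (suc s) i ∎

  bernsteinSum-q· : ∀ s d i → bernsteinSum (suc s) (q· d) i ≡ ([1-q]· bernsteinSum s d) i
  bernsteinSum-q· zero    d zero    = ring₀ (d 0)
    where
    ring₀ : ∀ a → 0ℤ + a * (1ℤ - 0ℤ) ≡ a * 1ℤ - 0ℤ
    ring₀ = solve-∀
  bernsteinSum-q· zero    d (suc i) = ring₁ (d 0) (δ 0 i)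
    where
    ring₁ : ∀ a x → 0ℤ * x + a * (0ℤ - x) ≡ a * 0ℤ - a * x
    ring₁ = solve-∀
  bernsteinSum-q· (suc s) d zero    = ring₀ (d (suc s)) (bernstein 0 (suc s) 0)
    where
    ring₀ : ∀ a x → 0ℤ + a * (x - 0ℤ) ≡ (0ℤ + a * x) - 0ℤ
    ring₀ = solve-∀
  bernsteinSum-q· (suc s) d (suc i) = begin
    bernsteinSum (suc s) (q· d) i + d (suc s) * (b (suc i) - b i)
      ≡⟨ cong (_+ d (suc s) * (b (suc i) - b i)) (bernsteinSum-q· s d i) ⟩
    (X i - (q· X) i) + d (suc s) * (b (suc i) - b i)
      ≡⟨ ring₁ (X i) ((q· X) i) (d (suc s)) (b (suc i)) (b i) ⟩
    (X i + d (suc s) * b (suc i)) - ((q· X) i + d (suc s) * b i) ∎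
    where
    X = bernsteinSum s d
    b = bernstein 0 (suc s)
    ring₁ : ∀ x qx a y z → (x - qx) + a * (y - z) ≡ (x + a * y) - (qx + a * z)
    ring₁ = solve-∀

  binomial : ℕ → ℕ → ℤ
  binomial t k = + (t C k)

  binomial-suc : ∀ t k → binomial (suc t) k ≡ binomial t k + (q· binomial t) k
  binomial-suc t zero    = refl
  binomial-suc t (suc k) = begin
    + (suc t C suc k)          ≡⟨ cong +_ (nCk+nC[k+1]≡[n+1]C[k+1] t k) ⟨
    + (t C k ℕ.+ t C suc k)    ≡⟨ pos-+ (t C k) (t C suc k) ⟩
    + (t C k) + + (t C suc k)  ≡⟨ +-comm (+ (t C k)) (+ (t C suc k)) ⟩
    + (t C suc k) + + (t C k)  ∎

  bernsteinSum-binomial : ∀ t i → bernsteinSum t (binomial t) i ≡ δ 0 i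
  bernsteinSum-q·binomial : ∀ t i → bernsteinSum (suc t) (q· binomial t) i ≡ ([1-q]· δ 0) i

  bernsteinSum-binomial zero    i = *-identityˡ (δ 0 i)
  bernsteinSum-binomial (suc t) i = begin
    bernsteinSum (suc t) (binomial (suc t)) i
      ≡⟨ bernsteinSum-cong (suc t) (λ k _ → binomial-suc t k) i ⟩
    bernsteinSum (suc t) (λ k → binomial t k + (q· binomial t) k) i
      ≡⟨ bernsteinSum-+ (suc t) (binomial t) (q· binomial t) i ⟩
    bernsteinSum (suc t) (binomial t) i + bernsteinSum (suc t) (q· binomial t) i
      ≡⟨ cong₂ _+_ upper (bernsteinSum-q·binomial t i) ⟩
    (q· δ 0) i + (δ 0 i - (q· δ 0) i)
      ≡⟨ ring (δ 0 i) ((q· δ 0) i) ⟩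
    δ 0 i ∎
    where
    ring : ∀ x y → y + (x - y) ≡ x
    ring = solve-∀
    upper : bernsteinSum (suc t) (binomial t) i ≡ (q· δ 0) i
    upper = begin
      (q· bernsteinSum t (binomial t)) i + + (t C suc t) * bernstein 0 (suc t) i
        ≡⟨ cong₂ (λ x c → x + + c * bernstein 0 (suc t) i)
                 (q·-cong (bernsteinSum-binomial t) i) (k>n⇒nCk≡0 (ℕₚ.n<1+n t)) ⟩
      (q· δ 0) i + 0ℤ
        ≡⟨ +-identityʳ _ ⟩
      (q· δ 0) i ∎

  bernsteinSum-q·binomial t i = trans (bernsteinSum-q· t (binomial t) i) ([1-q]·-cong (bernsteinSum-binomial t) i)

  linear-expansion : ∀ (f : ℕ → ℤ) → (∀ i → f (suc (suc i)) ≡ 0ℤ) →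
                     ∀ i → f i ≡ (f 0 + f 1) * δ 0 i + (- f 1) * ([1-q]· δ 0) i
  linear-expansion f f-linear zero          = ring₀ (f 0) (f 1)
    where
    ring₀ : ∀ x y → x ≡ (x + y) * 1ℤ + (- y) * (1ℤ - 0ℤ)
    ring₀ = solve-∀
  linear-expansion f f-linear (suc zero)    = ring₁ (f 0) (f 1)
    where
    ring₁ : ∀ x y → y ≡ (x + y) * 0ℤ + (- y) * (0ℤ - 1ℤ)
    ring₁ = solve-∀
  linear-expansion f f-linear (suc (suc i)) = trans (f-linear i) (ring₂ (f 0) (f 1))
    where
    ring₂ : ∀ x y → 0ℤ ≡ (x + y) * 0ℤ + (- y) * (0ℤ - 0ℤ)
    ring₂ = solve-∀

  bernsteinSum-α+β[1-q] : ∀ t α β i →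
    bernsteinSum (suc t) (λ k → α * binomial (suc t) k + β * (q· binomial t) k) i
      ≡ α * δ 0 i + β * ([1-q]· δ 0) i
  bernsteinSum-α+β[1-q] t α β i = begin
    bernsteinSum (suc t) (λ k → α * binomial (suc t) k + β * (q· binomial t) k) i
      ≡⟨ bernsteinSum-+ (suc t) _ _ i ⟩
    bernsteinSum (suc t) (λ k → α * binomial (suc t) k) i + bernsteinSum (suc t) (λ k → β * (q· binomial t) k) i
      ≡⟨ cong₂ _+_ (bernsteinSum-* (suc t) α _ i) (bernsteinSum-* (suc t) β _ i) ⟩
    α * bernsteinSum (suc t) (binomial (suc t)) i + β * bernsteinSum (suc t) (q· binomial t) i
      ≡⟨ cong₂ (λ x y → α * x + β * y) (bernsteinSum-binomial (suc t) i) (bernsteinSum-q·binomial t i) ⟩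
    α * δ 0 i + β * ([1-q]· δ 0) i ∎

  bernsteinSum-linear⇔q·binomial : ∀ t (d : ℕ → ℤ) → d 0 ≡ 0ℤ →
    (∀ i → bernsteinSum (suc t) d (suc (suc i)) ≡ 0ℤ) ⇔
    (∀ k → k ≤ suc t → d k ≡ d 1 * (q· binomial t) k)
  bernsteinSum-linear⇔q·binomial t d d₀≡0 = mk⇔ linear⇒ ⇒linear
    where
    ⇒linear : (∀ k → k ≤ suc t → d k ≡ d 1 * (q· binomial t) k) →
              ∀ i → bernsteinSum (suc t) d (suc (suc i)) ≡ 0ℤ
    ⇒linear d≡ i = begin
      bernsteinSum (suc t) d (2+i)
        ≡⟨ bernsteinSum-cong (suc t) d≡ (2+i) ⟩
      bernsteinSum (suc t) (λ k → d 1 * (q· binomial t) k) (2+i)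
        ≡⟨ bernsteinSum-* (suc t) (d 1) _ (2+i) ⟩
      d 1 * bernsteinSum (suc t) (q· binomial t) (2+i)
        ≡⟨ cong (d 1 *_) (bernsteinSum-q·binomial t (2+i)) ⟩
      d 1 * 0ℤ
        ≡⟨ *-zeroʳ (d 1) ⟩
      0ℤ ∎
      where 2+i = suc (suc i)

    linear⇒ : (∀ i → bernsteinSum (suc t) d (suc (suc i)) ≡ 0ℤ) →
              ∀ k → k ≤ suc t → d k ≡ d 1 * (q· binomial t) k
    linear⇒ linear k k≤1+t = begin
      d k                  ≡⟨ d≡β·v k k≤1+t ⟩
      β * v k              ≡⟨ cong (_* v k) (sym d₁≡β) ⟩
      d 1 * v k            ∎
      where
      f = bernsteinSum (suc t) d
      v = q· binomial t
      α = f 0 + f 1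
      β = - f 1
      d≡ : ∀ k → k ≤ suc t → d k ≡ α * binomial (suc t) k + β * v k
      d≡ = bernsteinSum-injective (suc t)
             (λ i → trans (linear-expansion f linear i) (sym (bernsteinSum-α+β[1-q] t α β i)))
      α≡0 : α ≡ 0ℤ
      α≡0 = trans (ring α β) (trans (sym (d≡ 0 z≤n)) d₀≡0)
        where
        ring : ∀ a b → a ≡ a * 1ℤ + b * 0ℤ
        ring = solve-∀
      d≡β·v : ∀ k → k ≤ suc t → d k ≡ β * v k
      d≡β·v k k≤1+t = begin
        d k                                    ≡⟨ d≡ k k≤1+t ⟩
        α * binomial (suc t) k + β * v k       ≡⟨ cong (λ a → a * binomial (suc t) k + β * v k) α≡0 ⟩
        0ℤ * binomial (suc t) k + β * v k      ≡⟨ +-identityˡ (β * v k) ⟩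
        β * v k                                ∎
      d₁≡β : d 1 ≡ β
      d₁≡β = trans (d≡β·v 1 (s≤s z≤n)) (*-identityʳ β)

  bernsteinSum-linear⇔binomial : ∀ s (N : ℕ → ℕ) → N 0 ≡ 0 →
    (∀ i → bernsteinSum s (+_ ∘ N) (suc (suc i)) ≡ 0ℤ) ⇔
    (∀ k → 1 ≤ k → k ≤ s → N k ≡ ((s ∸ 1) C (k ∸ 1)) ℕ.* N 1)
  bernsteinSum-linear⇔binomial zero    N N₀≡0 = mk⇔ (λ _ → vacuous) (λ _ i → *-zeroʳ (+ N 0))
    where
    vacuous : ∀ k → 1 ≤ k → k ≤ 0 → N k ≡ (0 C (k ∸ 1)) ℕ.* N 1
    vacuous (suc k) _ ()
  bernsteinSum-linear⇔binomial (suc t) N N₀≡0 = mk⇔ (⇒binomial ∘ to) (from ∘ binomial⇒)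
    where
    open Equivalence (bernsteinSum-linear⇔q·binomial t (+_ ∘ N) (cong +_ N₀≡0))
    pos-*-comm : ∀ m n → + (m ℕ.* n) ≡ + n * + m
    pos-*-comm m n = trans (pos-* m n) (*-comm (+ m) (+ n))
    ⇒binomial : (∀ k → k ≤ suc t → + N k ≡ + N 1 * (q· binomial t) k) →
                ∀ k → 1 ≤ k → k ≤ suc t → N k ≡ (t C (k ∸ 1)) ℕ.* N 1
    ⇒binomial N≡ (suc j) _ 1+j≤1+t = +-injective (trans (N≡ (suc j) 1+j≤1+t) (sym (pos-*-comm (t C j) (N 1))))
    binomial⇒ : (∀ k → 1 ≤ k → k ≤ suc t → N k ≡ (t C (k ∸ 1)) ℕ.* N 1) →
                ∀ k → k ≤ suc t → + N k ≡ + N 1 * (q· binomial t) k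
    binomial⇒ N≡ zero    _        = trans (cong +_ N₀≡0) (sym (*-zeroʳ (+ N 1)))
    binomial⇒ N≡ (suc j) 1+j≤1+t = trans (cong +_ (N≡ (suc j) (s≤s z≤n) 1+j≤1+t)) (pos-*-comm (t C j) (N 1))

  coeff-sumₚ-bernstein : ∀ {A : Set} s (size weight : A → ℕ) (xs : List A) →
                         All (λ x → size x ≤ s) xs → ∀ i →
    coeff (sumₚ (map (λ x → scaleₚ (+ weight x) ((qₚ ^ₚ (s ∸ size x)) *ₚ (1-qₚ ^ₚ size x))) xs)) i
      ≡ bernsteinSum s (λ k → + sum (map weight (filterᵇ (λ x → size x ≡ᵇ k) xs))) i
  coeff-sumₚ-bernstein s size weight []       []           i = sym (bernsteinSum-zero s _ (λ _ _ → refl) i)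
  coeff-sumₚ-bernstein {A} s size weight (x ∷ xs) (x≤s ∷ xs≤s) i = begin
    coeff (term x +ₚ sumₚ (map term xs)) i
      ≡⟨ coeff-+ₚ (term x) _ i ⟩
    coeff (term x) i + coeff (sumₚ (map term xs)) i
      ≡⟨ cong₂ _+_ (trans (coeff-scaleₚ (+ weight x) (bernsteinₚ x) i)
                          (cong (+ weight x *_) (coeff-bernstein (s ∸ size x) (size x) i)))
                   (coeff-sumₚ-bernstein s size weight xs xs≤s i) ⟩
    + weight x * bernstein (s ∸ size x) (size x) i + bernsteinSum s (weightOfSize xs) i
      ≡⟨ cong (λ y → + weight x * y + bernsteinSum s (weightOfSize xs) i) (bernsteinSum-δ s x≤s i) ⟨
    + weight x * bernsteinSum s (δ (size x)) i + bernsteinSum s (weightOfSize xs) i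
      ≡⟨ cong (_+ bernsteinSum s (weightOfSize xs) i) (bernsteinSum-* s (+ weight x) (δ (size x)) i) ⟨
    bernsteinSum s (λ k → + weight x * δ (size x) k) i + bernsteinSum s (weightOfSize xs) i
      ≡⟨ bernsteinSum-+ s _ _ i ⟨
    bernsteinSum s (λ k → + weight x * δ (size x) k + weightOfSize xs k) i
      ≡⟨ bernsteinSum-cong s (λ k _ → weightOfSize-∷ k) i ⟨
    bernsteinSum s (weightOfSize (x ∷ xs)) i ∎
    where
    bernsteinₚ term : A → Poly
    bernsteinₚ x = (qₚ ^ₚ (s ∸ size x)) *ₚ (1-qₚ ^ₚ size x)
    term x = scaleₚ (+ weight x) (bernsteinₚ x)
    weightOfSize : List A → ℕ → ℤ
    weightOfSize ys k = + sum (map weight (filterᵇ (λ y → size y ≡ᵇ k) ys))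
    weightOfSize-∷ : ∀ k → weightOfSize (x ∷ xs) k ≡ + weight x * δ (size x) k + weightOfSize xs k
    weightOfSize-∷ k with size x ≡ᵇ k
    ... | true  = trans (pos-+ (weight x) _) (cong (_+ weightOfSize xs k) (sym (*-identityʳ (+ weight x))))
    ... | false = trans (sym (+-identityˡ _)) (cong (_+ weightOfSize xs k) (sym (*-zeroʳ (+ weight x))))


module Subsets where

  open import Function.Base using (_∘_)
  open import Data.Bool.Base using (Bool; true; false; _∧_; T)
  open import Data.Nat.Base using (ℕ; zero; suc; _≤_; z≤n; s≤s; _≡ᵇ_)
  import Data.Nat.Properties as ℕₚ
  open import Data.Fin.Base using (Fin; zero; suc)
  open import Data.Fin.Properties using (_≟_)
  open import Data.Fin.Subset using (Subset; ∣_∣; ⊥)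
  open import Data.Vec.Base using ([]; _∷_; lookup; tabulate)
  open import Data.Vec.Properties using (tabulate-cong)
  open import Data.List.Base using (List; []; _∷_; map; filterᵇ; _++_; allFin)
  import Data.List.Base as List
  open import Data.List.Properties using (filter-++; ++-identityʳ; map-tabulate; map-∘; map-cong)
  open import Data.List.Relation.Unary.All as All using (All)
  open import Data.List.Relation.Unary.All.Properties using (all-filter)
  open import Data.List.Relation.Binary.Permutation.Propositional
    using (_↭_; ↭-refl; prep; module PermutationReasoning)
  open import Data.List.Relation.Binary.Permutation.Propositional.Properties using (map⁺; ++-comm)
  open import Relation.Nullary.Decidable using (T?; ⌊⌋-map′)
  open import Relation.Binary.PropositionalEquality
    using (_≡_; refl; trans; cong; cong₂; module ≡-Reasoning)

  private
    variable
      n : ℕ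

  ⊆ᵇ⇒∣∣≤ : (W S : Subset n) → T (W ⊆ᵇ S) → ∣ W ∣ ≤ ∣ S ∣
  ⊆ᵇ⇒∣∣≤ []          []          _    = z≤n
  ⊆ᵇ⇒∣∣≤ (false ∷ W) (false ∷ S) W⊆S = ⊆ᵇ⇒∣∣≤ W S W⊆S
  ⊆ᵇ⇒∣∣≤ (false ∷ W) (true ∷ S)  W⊆S = ℕₚ.m≤n⇒m≤1+n (⊆ᵇ⇒∣∣≤ W S W⊆S)
  ⊆ᵇ⇒∣∣≤ (true ∷ W)  (true ∷ S)  W⊆S = s≤s (⊆ᵇ⇒∣∣≤ W S W⊆S)

  subsetsOf-∣∣≤ : (S : Subset n) → All (λ W → ∣ W ∣ ≤ ∣ S ∣) (subsetsOf S)
  subsetsOf-∣∣≤ {n} S = All.map (λ {W} → ⊆ᵇ⇒∣∣≤ W S) (all-filter (T? ∘ (_⊆ᵇ S)) (allSubsets n))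

  filterᵇ-map : ∀ {A B : Set} (p : B → Bool) (f : A → B) xs →
                filterᵇ p (map f xs) ≡ map f (filterᵇ (p ∘ f) xs)
  filterᵇ-map p f []       = refl
  filterᵇ-map p f (x ∷ xs) with p (f x)
  ... | true  = cong (f x ∷_) (filterᵇ-map p f xs)
  ... | false = filterᵇ-map p f xs

  filterᵇ-false : ∀ {A : Set} (xs : List A) → filterᵇ (λ _ → false) xs ≡ []
  filterᵇ-false []       = refl
  filterᵇ-false (x ∷ xs) = filterᵇ-false xs

  subsetsOfSize-∷ : ∀ s (S : Subset n) k →
    subsetsOfSize (s ∷ S) k ≡
      map (false ∷_) (subsetsOfSize S k) ++
      map (true ∷_) (filterᵇ (λ W → suc ∣ W ∣ ≡ᵇ k) (filterᵇ (λ W → s ∧ (W ⊆ᵇ S)) (allSubsets n)))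
  subsetsOfSize-∷ {n} s S k = begin
    ofSize (inS (map (false ∷_) A ++ map (true ∷_) A))
      ≡⟨ cong ofSize (filter-++ (T? ∘ (_⊆ᵇ (s ∷ S))) (map (false ∷_) A) (map (true ∷_) A)) ⟩
    ofSize (inS (map (false ∷_) A) ++ inS (map (true ∷_) A))
      ≡⟨ filter-++ (T? ∘ λ W → ∣ W ∣ ≡ᵇ k) (inS (map (false ∷_) A)) (inS (map (true ∷_) A)) ⟩
    ofSize (inS (map (false ∷_) A)) ++ ofSize (inS (map (true ∷_) A))
      ≡⟨ cong₂ _++_ (ofSize-inS-map (false ∷_)) (ofSize-inS-map (true ∷_)) ⟩
    _ ∎
    where
    open ≡-Reasoning
    A = allSubsets n
    inS ofSize : List (Subset (suc n)) → List (Subset (suc n))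
    inS    = filterᵇ (_⊆ᵇ (s ∷ S))
    ofSize = filterᵇ (λ W → ∣ W ∣ ≡ᵇ k)
    ofSize-inS-map : (f : Subset n → Subset (suc n)) →
      ofSize (inS (map f A)) ≡
        map f (filterᵇ (λ W → ∣ f W ∣ ≡ᵇ k) (filterᵇ (λ W → f W ⊆ᵇ (s ∷ S)) A))
    ofSize-inS-map f = trans (cong ofSize (filterᵇ-map (_⊆ᵇ (s ∷ S)) f A))
                             (filterᵇ-map (λ W → ∣ W ∣ ≡ᵇ k) f (filterᵇ (λ W → f W ⊆ᵇ (s ∷ S)) A))

  subsetsOfSize-false∷ : ∀ (S : Subset n) k → subsetsOfSize (false ∷ S) k ≡ map (false ∷_) (subsetsOfSize S k)
  subsetsOfSize-false∷ {n} S k = begin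
    subsetsOfSize (false ∷ S) k
      ≡⟨ subsetsOfSize-∷ false S k ⟩
    map (false ∷_) (subsetsOfSize S k) ++ map (true ∷_) (ofSucSize (filterᵇ (λ _ → false) (allSubsets n)))
      ≡⟨ cong (λ ws → map (false ∷_) (subsetsOfSize S k) ++ map (true ∷_) (ofSucSize ws))
              (filterᵇ-false (allSubsets n)) ⟩
    map (false ∷_) (subsetsOfSize S k) ++ []
      ≡⟨ ++-identityʳ _ ⟩
    map (false ∷_) (subsetsOfSize S k) ∎
    where
    open ≡-Reasoning
    ofSucSize : List (Subset n) → List (Subset n)
    ofSucSize = filterᵇ (λ W → suc ∣ W ∣ ≡ᵇ k)

  subsetsOfSize-zero : ∀ (S : Subset n) → subsetsOfSize S 0 ≡ ⊥ ∷ []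
  subsetsOfSize-zero []          = refl
  subsetsOfSize-zero (false ∷ S) = trans (subsetsOfSize-false∷ S 0) (cong (map (false ∷_)) (subsetsOfSize-zero S))
  subsetsOfSize-zero (true ∷ S)  = begin
    subsetsOfSize (true ∷ S) 0
      ≡⟨ subsetsOfSize-∷ true S 0 ⟩
    map (false ∷_) (subsetsOfSize S 0) ++ map (true ∷_) (filterᵇ (λ _ → false) (subsetsOf S))
      ≡⟨ cong₂ (λ ws vs → map (false ∷_) ws ++ map (true ∷_) vs)
               (subsetsOfSize-zero S) (filterᵇ-false (subsetsOf S)) ⟩
    ⊥ ∷ [] ∎
    where open ≡-Reasoning

  tabulate-false : ∀ {f : Fin n → Bool} → (∀ x → f x ≡ false) → tabulate f ≡ ⊥
  tabulate-false {zero}  f≗false = refl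
  tabulate-false {suc n} f≗false = cong₂ _∷_ (f≗false zero) (tabulate-false (f≗false ∘ suc))

  singleton-zero : singleton {suc n} zero ≡ true ∷ ⊥
  singleton-zero = cong (true ∷_) (tabulate-false λ _ → refl)

  singleton-suc : ∀ (v : Fin n) → singleton (suc v) ≡ false ∷ singleton v
  singleton-suc v = cong (false ∷_) (tabulate-cong λ u → ⌊⌋-map′ _ _ (u ≟ v))

  singletons-suc : ∀ s (S : Subset n) →
    map singleton (filterᵇ (lookup (s ∷ S)) (List.tabulate suc)) ≡ map (false ∷_) (map singleton (elemsOf S))
  singletons-suc {n} s S = begin
    map singleton (filterᵇ (lookup (s ∷ S)) (List.tabulate suc))
      ≡⟨ cong (map singleton ∘ filterᵇ (lookup (s ∷ S))) (map-tabulate (λ v → v) suc) ⟨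
    map singleton (filterᵇ (lookup (s ∷ S)) (map suc (allFin n)))
      ≡⟨ cong (map singleton) (filterᵇ-map (lookup (s ∷ S)) suc (allFin n)) ⟩
    map singleton (map suc (elemsOf S))
      ≡⟨ map-∘ (elemsOf S) ⟨
    map (singleton ∘ suc) (elemsOf S)
      ≡⟨ map-cong singleton-suc (elemsOf S) ⟩
    map ((false ∷_) ∘ singleton) (elemsOf S)
      ≡⟨ map-∘ (elemsOf S) ⟩
    map (false ∷_) (map singleton (elemsOf S)) ∎
    where open ≡-Reasoning

  subsetsOfSize-one : ∀ (S : Subset n) → subsetsOfSize S 1 ↭ map singleton (elemsOf S)
  subsetsOfSize-one []          = ↭-refl
  subsetsOfSize-one (false ∷ S) = begin
    subsetsOfSize (false ∷ S) 1                   ≡⟨ subsetsOfSize-false∷ S 1 ⟩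
    map (false ∷_) (subsetsOfSize S 1)            ↭⟨ map⁺ (false ∷_) (subsetsOfSize-one S) ⟩
    map (false ∷_) (map singleton (elemsOf S))    ≡⟨ singletons-suc false S ⟨
    map singleton (elemsOf (false ∷ S))           ∎
    where open PermutationReasoning
  subsetsOfSize-one (true ∷ S)  = begin
    subsetsOfSize (true ∷ S) 1
      ≡⟨ subsetsOfSize-∷ true S 1 ⟩
    map (false ∷_) (subsetsOfSize S 1) ++ map (true ∷_) (subsetsOfSize S 0)
      ≡⟨ cong (λ ws → map (false ∷_) (subsetsOfSize S 1) ++ map (true ∷_) ws) (subsetsOfSize-zero S) ⟩
    map (false ∷_) (subsetsOfSize S 1) ++ (true ∷ ⊥) ∷ []
      ↭⟨ ++-comm (map (false ∷_) (subsetsOfSize S 1)) _ ⟩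
    (true ∷ ⊥) ∷ map (false ∷_) (subsetsOfSize S 1)
      ↭⟨ prep (true ∷ ⊥) (map⁺ (false ∷_) (subsetsOfSize-one S)) ⟩
    (true ∷ ⊥) ∷ map (false ∷_) (map singleton (elemsOf S))
      ≡⟨ cong₂ _∷_ singleton-zero (singletons-suc true S) ⟨
    map singleton (elemsOf (true ∷ S)) ∎
    where open PermutationReasoning

open import Data.Nat using (ℕ; _≤_; _*_; _∸_)
open import Data.Nat.Combinatorics using (_C_)
open import Data.Fin.Subset using (Subset; ∣_∣)
open import Data.List using (map)
open import Data.Nat.ListAction using (sum)
open import Relation.Binary.PropositionalEquality using (_≡_)
open import Function.Bundles using (_⇔_)

open import Function.Base using (_∘_)
open import Function.Bundles using (mk⇔)
open import Function.Construct.Composition using (_⇔-∘_)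
open import Data.Bool.Base using (Bool; false; _∧_; _∨_)
open import Data.Bool.ListAction using (any)
open import Data.Nat.Base using (zero; suc; _+_)
open import Data.Nat.Properties using (+-identityʳ)
open import Data.Nat.ListAction.Properties using (sum-↭)
open import Data.Integer.Base using (+_; 0ℤ)
open import Data.Fin.Base using (Fin)
open import Data.Fin.Subset using (⊥)
open import Data.Fin.Subset.Properties using (∣⊥∣≡0)
open import Data.Vec.Properties using (lookup-replicate)
open import Data.List.Base using (List; []; _∷_; allFin)
open import Data.List.Properties using (map-∘)
open import Data.List.Relation.Binary.Permutation.Propositional.Properties using (map⁺)
open import Relation.Binary.PropositionalEquality using (refl; sym; trans; cong; cong₂; module ≡-Reasoning)
open Bernstein
open Subsets

iterate-fixed : ∀ {A : Set} {f : A → A} {a} k → f a ≡ a → iterate k f a ≡ a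
iterate-fixed zero    fa≡a = refl
iterate-fixed (suc k) fa≡a rewrite fa≡a = iterate-fixed k fa≡a

skips-all : ∀ {A B : Set} {f : List A → B} → (∀ x xs → f (x ∷ xs) ≡ f xs) → ∀ xs → f xs ≡ f []
skips-all skip []       = refl
skips-all skip (x ∷ xs) = trans (skip x xs) (skips-all skip xs)

any-false : ∀ {A : Set} (p : A → Bool) (xs : List A) → (∀ x → p x ≡ false) → any p xs ≡ false
any-false p []       p≗false = refl
any-false p (x ∷ xs) p≗false = cong₂ _∨_ (p≗false x) (any-false p xs p≗false)

module _ {n} (G : Graph n) where

  closedNbhd-⊥ : closedNbhd G ⊥ ≡ ⊥
  closedNbhd-⊥ = tabulate-false λ y → any-false _ (allFin n) λ x → cong (_∧ inN G x y) (lookup-replicate x false)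

  -- scan is solved by unification as the loop local to forceStep, which cannot be named directly.
  mutual
    private
      scan : List (Fin n) → Subset n
      scan = _

    forceStep-⊥ : forceStep G ⊥ ≡ ⊥
    forceStep-⊥ with allFin n
    ... | xs = skips-all {f = scan} scan-skips xs

    private
      scan-skips : ∀ x xs → scan (x ∷ xs) ≡ scan xs
      scan-skips x xs rewrite lookup-replicate x false = refl

  Obs-⊥ : Obs G ⊥ ≡ ⊥
  Obs-⊥ = trans (cong (iterate n (forceStep G)) closedNbhd-⊥) (iterate-fixed n forceStep-⊥)

obsBySize : ∀ {n} → Graph n → Subset n → ℕ → ℕ
obsBySize G S k = sum (map (λ W → ∣ Obs G W ∣) (subsetsOfSize S k))

module _ {n} (G : Graph n) (S : Subset n) where

  coeff-expObs : ∀ i → coeff (expObs G S) i ≡ bernsteinSum ∣ S ∣ (+_ ∘ obsBySize G S) i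
  coeff-expObs = coeff-sumₚ-bernstein ∣ S ∣ ∣_∣ (λ W → ∣ Obs G W ∣) (subsetsOf S) (subsetsOf-∣∣≤ S)

  IsLinear-expObs⇔ : IsLinear (expObs G S) ⇔
                     (∀ i → bernsteinSum ∣ S ∣ (+_ ∘ obsBySize G S) (suc (suc i)) ≡ 0ℤ)
  IsLinear-expObs⇔ = mk⇔ (λ linear i → trans (sym (coeff-expObs (suc (suc i)))) (linear i))
                         (λ linear i → trans (coeff-expObs (suc (suc i))) (linear i))

  obsBySize-zero : obsBySize G S 0 ≡ 0
  obsBySize-zero = begin
    sum (map (λ W → ∣ Obs G W ∣) (subsetsOfSize S 0))
      ≡⟨ cong (sum ∘ map (λ W → ∣ Obs G W ∣)) (subsetsOfSize-zero S) ⟩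
    ∣ Obs G ⊥ ∣ + 0
      ≡⟨ +-identityʳ _ ⟩
    ∣ Obs G ⊥ ∣
      ≡⟨ cong ∣_∣ (Obs-⊥ G) ⟩
    ∣ ⊥ {n} ∣
      ≡⟨ ∣⊥∣≡0 n ⟩
    0 ∎
    where open ≡-Reasoning

  obsBySize-one : obsBySize G S 1 ≡ sum (map (λ v → ∣ Obs G (singleton v) ∣) (elemsOf S))
  obsBySize-one =
    trans (sum-↭ (map⁺ (λ W → ∣ Obs G W ∣) (subsetsOfSize-one S))) (cong sum (sym (map-∘ (elemsOf S))))

theorem3p3 : (n : ℕ) (G : Graph n) (S : Subset n) →
    IsLinear (expObs G S) ⇔
      (∀ k → 1 ≤ k → k ≤ ∣ S ∣ →
        sum (map (λ W → ∣ Obs G W ∣) (subsetsOfSize S k))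
          ≡ ((∣ S ∣ ∸ 1) C (k ∸ 1)) * sum (map (λ v → ∣ Obs G (singleton v) ∣) (elemsOf S)))
theorem3p3 n G S rewrite sym (obsBySize-one G S) =
  bernsteinSum-linear⇔binomial ∣ S ∣ (obsBySize G S) (obsBySize-zero G S) ⇔-∘ IsLinear-expObs⇔ G S
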